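{- Let $G$ be a graph with $\underline{f}(G)\ge 2$. Then $\mathrm{MObs}(G;i)\ge 2$ for all $i\in\{1,\dots,\gamma_P(G)\}$.
   Context: Graphs are finite and simple with at least one vertex. Power domination: from $S\subseteq V(G)$, first $N[S]$ is observed; then repeatedly, while an observed vertex has exactly one unobserved neighbor, that neighbor becomes observed; the final set is $\mathrm{Obs}(G;S)$. $\gamma_P(G)$ is the least $|S|$ with $\mathrm{Obs}(G;S)=V(G)$. $\mathrm{maxObs}(G;k):=\max_{|S|=k}|\mathrm{Obs}(G;S)|$ and $\mathrm{MObs}(G;k):=\mathrm{maxObs}(G;k)-\mathrm{maxObs}(G;k-1)$. A fort is a nonempty $F\subseteq V(G)$ such that no vertex of $V(G)\setminus F$ has exactly one neighbor in $F$; $\underline{f}(G)$ is the minimum size of a fort. -}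

module Defs where

open import Data.Bool using (Bool; true; false; _∧_; _∨_; not; if_then_else_)
open import Data.Nat using (ℕ; zero; suc; _≡ᵇ_; _⊔_; _⊓_; _+_)
open import Data.Fin using (Fin)
open import Data.List using (List; []; _∷_; _++_; map; foldr)
open import Data.Bool.ListAction using (any; all)
open import Data.Vec using (Vec; []; _∷_; lookup; tabulate; replicate)
open import Data.Fin.Subset using (Subset; ∣_∣)
open import Data.List.Base using () renaming (allFin to finList)
open import Relation.Binary.PropositionalEquality using (_≡_)
open import Relation.Nullary.Decidable using (does)

record Graph (n : ℕ) : Set where
  field
    adj     : Fin n → Fin n → Bool
    adj-sym : ∀ u v → adj u v ≡ adj v u
    irrefl  : ∀ v → adj v v ≡ false
open Graph public

anyV : ∀ {n} → (Fin n → Bool) → Bool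
anyV {n} p = any p (finList n)

allV : ∀ {n} → (Fin n → Bool) → Bool
allV {n} p = all p (finList n)

countV : ∀ {n} → (Fin n → Bool) → ℕ
countV p = ∣ tabulate p ∣

closedNbhd : ∀ {n} → Graph n → Subset n → Subset n
closedNbhd G S = tabulate λ v → lookup S v ∨ anyV (λ u → lookup S u ∧ adj G u v)

unobsNbrs : ∀ {n} → Graph n → Subset n → Fin n → ℕ
unobsNbrs G O u = countV (λ w → adj G u w ∧ not (lookup O w))

step : ∀ {n} → Graph n → Subset n → Subset n
step G O = tabulate λ v → lookup O v ∨
  anyV (λ u → lookup O u ∧ adj G u v ∧ not (lookup O v) ∧ (unobsNbrs G O u ≡ᵇ 1))

iter : ∀ {n} → ℕ → Graph n → Subset n → Subset n
iter zero    G O = O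
iter (suc k) G O = iter k G (step G O)

-- Obs(G;S): n propagation rounds suffice to reach the final set
Obs : ∀ {n} → Graph n → Subset n → Subset n
Obs {n} G S = iter n G (closedNbhd G S)

allSubsets : ∀ n → List (Subset n)
allSubsets zero    = [] ∷ []
allSubsets (suc n) = map (true ∷_) (allSubsets n) ++ map (false ∷_) (allSubsets n)

maxObs : ∀ {n} → Graph n → ℕ → ℕ
maxObs {n} G k =
  foldr (λ S m → if ∣ S ∣ ≡ᵇ k then ∣ Obs G S ∣ ⊔ m else m) 0 (allSubsets n)

isFull : ∀ {n} → Subset n → Bool
isFull O = allV (lookup O)

pdsOfSize : ∀ {n} → Graph n → ℕ → Bool
pdsOfSize {n} G k = any (λ S → (∣ S ∣ ≡ᵇ k) ∧ isFull (Obs G S)) (allSubsets n)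

searchPD : ∀ {n} → Graph n → ℕ → ℕ → ℕ
searchPD G zero       k = k
searchPD G (suc fuel) k = if pdsOfSize G k then k else searchPD G fuel (suc k)

-- γ_P(G): V(G) itself is power dominating, so the search over 0..n succeeds
γP : ∀ {n} → Graph n → ℕ
γP {n} G = searchPD G (suc n) 0

isFort : ∀ {n} → Graph n → Subset n → Bool
isFort G F = anyV (lookup F) ∧
  allV (λ v → lookup F v ∨ not (countV (λ u → adj G v u ∧ lookup F u) ≡ᵇ 1))

-- minimum fort size (V(G) is a fort when n ≥ 1, so the initial value n
-- never exceeds the true minimum)
minFort : ∀ {n} → Graph n → ℕ
minFort {n} G = foldr (λ F m → if isFort G F then ∣ F ∣ ⊓ m else m) n (allSubsets n)

-- Take S of size i − 1 observing maxObs(G; i − 1) vertices. Since i − 1 < γ_P(G), some vertex v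
-- is unobserved, and since {v} is not a fort, v has a neighbour w. If w is unobserved, adding v
-- to S observes both v and w. Otherwise w is observed but cannot force v, so it has a second
-- unobserved neighbour b, and adding w observes v and b. As observation is monotone in S, the
-- new set of size i observes at least two more vertices.
module Submission where

open import Defs
open import Data.Nat using (ℕ; zero; suc; _≤_; _<_; _+_; _∸_; _⊔_; _⊓_; _≡ᵇ_; z≤n; s≤s)
open import Data.Nat.Properties
  using (≤-refl; ≤-trans; ≤-pred; ≤-antisym; ≤-reflexive; <⇒≱; m≤n⇒m<n∨m≡n; n≤0⇒n≡0; m≤m+n;
         +-suc; +-comm; +-identityʳ; +-monoʳ-≤; ⊔-sel; ⊔-identityʳ; m⊓n≤m; m⊓n≤n; m≤m⊔n; m≤n⊔m; ≡ᵇ⇒≡; ≡⇒≡ᵇ;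
         module ≤-Reasoning)
open import Data.Bool using (Bool; true; false; _∧_; not; if_then_else_; T; T?)
open import Data.Bool.Properties using (T-∧; T-∨; T-≡)
open import Data.List using (List; []; _∷_; foldr; allFin)
open import Data.List.Membership.Propositional using (find; lose) renaming (_∈_ to _∈ₗ_)
open import Data.List.Membership.Propositional.Properties using (∈-allFin; ∈-map⁺; ∈-++⁺ˡ; ∈-++⁺ʳ)
open import Data.List.Relation.Unary.Any using (here; there)
open import Data.List.Relation.Unary.Any.Properties using (any⁺; any⁻)
open import Data.List.Relation.Unary.All.Properties using (all⁻; tabulate⁺)
open import Data.Vec using ([]; _∷_; lookup; tabulate)
import Data.Vec as Vec
open import Data.Vec.Properties using (lookup∘tabulate; []=⇒lookup; lookup⇒[]=)
import Data.Fin as Fin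
open import Data.Fin using (Fin)
open import Data.Fin.Properties using (any?; ¬∀⟶∃¬)
open import Data.Fin.Subset
  using (Subset; inside; outside; ∣_∣; ⁅_⁆; ⊤; _∪_; _∈_; _∉_; _⊆_; _⊂_; Empty)
open import Data.Fin.Subset.Properties
  using (_∈?_; _⊂?_; ∈⊤; ⊆-antisym; p⊆q⇒∣p∣≤∣q∣; p⊂q⇒∣p∣<∣q∣; ∣p∣≤n; ∣p∣≡n⇒p≡⊤; ∣⊥∣≡0;
         ∣⁅x⁆∣≡1; x∈⁅x⁆; x∈⁅y⁆⇒x≡y; x∉⁅y⁆⇒x≢y; Empty-unique; x∈p∪q⁺; x∈p∪q⁻; p⊆p∪q; ∪-identityʳ)
open import Data.Product using (∃; _×_; _,_)
open import Data.Sum using (_⊎_; inj₁; inj₂)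
import Data.Sum as Sum
open import Function.Base using (_∘_)
open import Function.Bundles using (Equivalence)
open import Relation.Nullary using (¬_; yes; no; contradiction)
open import Relation.Nullary.Decidable using (decidable-stable)
open import Relation.Binary.PropositionalEquality using (_≡_; _≢_; refl; sym; trans; cong; subst)

open Equivalence using (to; from)

private
  variable
    n k : ℕ
    x y u v w : Fin n
    p q S S′ O O′ : Subset n

∈⇒T : x ∈ p → T (lookup p x)
∈⇒T x∈p = from T-≡ ([]=⇒lookup x∈p)

T⇒∈ : T (lookup p x) → x ∈ p
T⇒∈ t = lookup⇒[]= _ _ (to T-≡ t)

∉⇒T-not : x ∉ p → T (not (lookup p x))
∉⇒T-not {x = x} {p} x∉p with lookup p x in eq
... | true  = x∉p (lookup⇒[]= _ _ eq)
... | false = _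

T-not⇒∉ : T (not (lookup p x)) → x ∉ p
T-not⇒∉ t x∈p = subst (T ∘ not) ([]=⇒lookup x∈p) t

∈-tabulate⁺ : {f : Fin n → Bool} → T (f x) → x ∈ tabulate f
∈-tabulate⁺ {x = x} {f} t = T⇒∈ (subst T (sym (lookup∘tabulate f x)) t)

∈-tabulate⁻ : {f : Fin n → Bool} → x ∈ tabulate f → T (f x)
∈-tabulate⁻ {x = x} {f} x∈ = subst T (lookup∘tabulate f x) (∈⇒T x∈)

anyV⁺ : {P : Fin n → Bool} → T (P x) → T (anyV P)
anyV⁺ {x = x} {P = P} t = any⁺ P (lose (∈-allFin x) t)

anyV⁻ : {P : Fin n → Bool} → T (anyV P) → ∃ λ x → T (P x)
anyV⁻ {n = n} {P = P} t with find (any⁻ P (allFin n) t)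
... | x , _ , px = x , px

allV⁺ : {P : Fin n → Bool} → (∀ x → T (P x)) → T (allV P)
allV⁺ {n = n} {P = P} h = all⁻ P {xs = allFin n} (tabulate⁺ h)

module _ {A : Set} (P : A → Bool) (f : A → ℕ) where

  maxWhere : List A → ℕ
  maxWhere = foldr (λ a m → if P a then f a ⊔ m else m) 0

  minWhere : ℕ → List A → ℕ
  minWhere c = foldr (λ a m → if P a then f a ⊓ m else m) c

  ≤-maxWhere : ∀ {a} as → a ∈ₗ as → T (P a) → f a ≤ maxWhere as
  ≤-maxWhere (a ∷ as) (here refl) Pa with P a
  ... | true = m≤m⊔n (f a) _
  ≤-maxWhere (b ∷ as) (there a∈as) Pa with P b
  ... | true  = ≤-trans (≤-maxWhere as a∈as Pa) (m≤n⊔m (f b) _)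
  ... | false = ≤-maxWhere as a∈as Pa

  maxWhere-attained : ∀ as → maxWhere as ≡ 0 ⊎ ∃ λ a → T (P a) × maxWhere as ≡ f a
  maxWhere-attained [] = inj₁ refl
  maxWhere-attained (b ∷ as) with P b in Pb | maxWhere-attained as
  ... | false | rest = rest
  ... | true  | inj₁ m≡0 = inj₂ (b , subst T (sym Pb) _ , trans (cong (f b ⊔_) m≡0) (⊔-identityʳ (f b)))
  ... | true  | inj₂ (a , Pa , m≡fa) with ⊔-sel (f b) (maxWhere as)
  ...   | inj₁ ⊔≡fb = inj₂ (b , subst T (sym Pb) _ , ⊔≡fb)
  ...   | inj₂ ⊔≡m  = inj₂ (a , Pa , trans ⊔≡m m≡fa)

  minWhere-≤ : ∀ {a} c as → a ∈ₗ as → T (P a) → minWhere c as ≤ f a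
  minWhere-≤ c (a ∷ as) (here refl) Pa with P a
  ... | true = m⊓n≤m (f a) _
  minWhere-≤ c (b ∷ as) (there a∈as) Pa with P b
  ... | true  = ≤-trans (m⊓n≤n (f b) _) (minWhere-≤ c as a∈as Pa)
  ... | false = minWhere-≤ c as a∈as Pa

∈-allSubsets : (S : Subset n) → S ∈ₗ allSubsets n
∈-allSubsets []            = here refl
∈-allSubsets (inside ∷ S)  = ∈-++⁺ˡ (∈-map⁺ (inside ∷_) (∈-allSubsets S))
∈-allSubsets (outside ∷ S) = ∈-++⁺ʳ _ (∈-map⁺ (outside ∷_) (∈-allSubsets S))

subsetOfSize : k ≤ n → ∃ λ (S : Subset n) → ∣ S ∣ ≡ k
subsetOfSize {n = zero}  z≤n     = [] , refl
subsetOfSize {n = suc n} z≤n     with subsetOfSize {n = n} z≤n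
... | S , ∣S∣≡0 = outside ∷ S , ∣S∣≡0
subsetOfSize         (s≤s k≤n) with subsetOfSize k≤n
... | S , ∣S∣≡k = inside ∷ S , cong suc ∣S∣≡k

x∈p⇒0<∣p∣ : x ∈ p → 0 < ∣ p ∣
x∈p⇒0<∣p∣ {x = x} {p} x∈p = subst (_≤ ∣ p ∣) (∣⁅x⁆∣≡1 x) (p⊆q⇒∣p∣≤∣q∣ ⁅x⁆⊆p)
  where
  ⁅x⁆⊆p : ⁅ x ⁆ ⊆ p
  ⁅x⁆⊆p y∈⁅x⁆ = subst (_∈ p) (sym (x∈⁅y⁆⇒x≡y x y∈⁅x⁆)) x∈p

∣p∪⁅x⁆∣≡1+∣p∣ : x ∉ p → ∣ p ∪ ⁅ x ⁆ ∣ ≡ suc ∣ p ∣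
∣p∪⁅x⁆∣≡1+∣p∣ {x = Fin.zero}  {outside ∷ p} _   = cong (suc ∘ ∣_∣) (∪-identityʳ p)
∣p∪⁅x⁆∣≡1+∣p∣ {x = Fin.zero}  {inside ∷ p}  x∉p = contradiction Vec.here x∉p
∣p∪⁅x⁆∣≡1+∣p∣ {x = Fin.suc x} {outside ∷ p} x∉p = ∣p∪⁅x⁆∣≡1+∣p∣ (x∉p ∘ Vec.there)
∣p∪⁅x⁆∣≡1+∣p∣ {x = Fin.suc x} {inside ∷ p}  x∉p = cong suc (∣p∪⁅x⁆∣≡1+∣p∣ (x∉p ∘ Vec.there))

⊆∧⊄⇒≡ : p ⊆ q → ¬ p ⊂ q → p ≡ q
⊆∧⊄⇒≡ {p = p} {q} p⊆q p⊄q = ⊆-antisym p⊆q q⊆p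
  where
  q⊆p : q ⊆ p
  q⊆p {x} x∈q = decidable-stable (x ∈? p) λ x∉p → p⊄q (p⊆q , x , x∈q , x∉p)

x∈p∧∣p∣≢1⇒∃y≢x : x ∈ p → ∣ p ∣ ≢ 1 → ∃ λ y → y ∈ p × y ≢ x
x∈p∧∣p∣≢1⇒∃y≢x {x = x} {p} x∈p ∣p∣≢1 with ⁅ x ⁆ ⊂? p
... | yes (_ , y , y∈p , y∉⁅x⁆) = y , y∈p , x∉⁅y⁆⇒x≢y y∉⁅x⁆
... | no  ⁅x⁆⊄p = contradiction (trans (cong ∣_∣ (sym (⊆∧⊄⇒≡ ⁅x⁆⊆p ⁅x⁆⊄p))) (∣⁅x⁆∣≡1 x)) ∣p∣≢1
  where
  ⁅x⁆⊆p : ⁅ x ⁆ ⊆ p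
  ⁅x⁆⊆p y∈⁅x⁆ = subst (_∈ p) (sym (x∈⁅y⁆⇒x≡y x y∈⁅x⁆)) x∈p

∣p∣+2≤∣q∣ : p ⊆ q → x ≢ y → x ∈ q → x ∉ p → y ∈ q → y ∉ p → ∣ p ∣ + 2 ≤ ∣ q ∣
∣p∣+2≤∣q∣ {p = p} {q} {x} {y} p⊆q x≢y x∈q x∉p y∈q y∉p = begin
  ∣ p ∣ + 2         ≡⟨ +-comm ∣ p ∣ 2 ⟩
  suc (suc ∣ p ∣)   ≡⟨ cong suc (∣p∪⁅x⁆∣≡1+∣p∣ x∉p) ⟨
  suc ∣ p ∪ ⁅ x ⁆ ∣ ≤⟨ p⊂q⇒∣p∣<∣q∣ (p∪⁅x⁆⊆q , y , y∈q , y∉p∪⁅x⁆) ⟩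
  ∣ q ∣             ∎
  where
  open ≤-Reasoning
  p∪⁅x⁆⊆q : p ∪ ⁅ x ⁆ ⊆ q
  p∪⁅x⁆⊆q z∈ with x∈p∪q⁻ p ⁅ x ⁆ z∈
  ... | inj₁ z∈p   = p⊆q z∈p
  ... | inj₂ z∈⁅x⁆ = subst (_∈ q) (sym (x∈⁅y⁆⇒x≡y x z∈⁅x⁆)) x∈q
  y∉p∪⁅x⁆ : y ∉ p ∪ ⁅ x ⁆
  y∉p∪⁅x⁆ y∈ with x∈p∪q⁻ p ⁅ x ⁆ y∈
  ... | inj₁ y∈p   = y∉p y∈p
  ... | inj₂ y∈⁅x⁆ = x≢y (sym (x∈⁅y⁆⇒x≡y x y∈⁅x⁆))

module _ (G : Graph n) where

  adj⇒≢ : T (adj G u v) → u ≢ v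
  adj⇒≢ {u = u} uv refl = subst T (irrefl G u) uv

  adj-symᵀ : T (adj G u v) → T (adj G v u)
  adj-symᵀ {u = u} {v} = subst T (adj-sym G u v)

  ∈-closedNbhd⁺ : v ∈ S ⊎ (∃ λ u → u ∈ S × T (adj G u v)) → v ∈ closedNbhd G S
  ∈-closedNbhd⁺ (inj₁ v∈S) = ∈-tabulate⁺ (from T-∨ (inj₁ (∈⇒T v∈S)))
  ∈-closedNbhd⁺ (inj₂ (u , u∈S , uv)) =
    ∈-tabulate⁺ (from T-∨ (inj₂ (anyV⁺ {x = u} (from T-∧ (∈⇒T u∈S , uv)))))

  ∈-closedNbhd⁻ : v ∈ closedNbhd G S → v ∈ S ⊎ ∃ λ u → u ∈ S × T (adj G u v)
  ∈-closedNbhd⁻ v∈N with to T-∨ (∈-tabulate⁻ v∈N)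
  ... | inj₁ v∈S = inj₁ (T⇒∈ v∈S)
  ... | inj₂ nbr with anyV⁻ nbr
  ...   | u , u∈S∧uv with to T-∧ u∈S∧uv
  ...     | u∈S , uv = inj₂ (u , T⇒∈ u∈S , uv)

  closedNbhd-mono : S ⊆ S′ → closedNbhd G S ⊆ closedNbhd G S′
  closedNbhd-mono S⊆S′ v∈N with ∈-closedNbhd⁻ v∈N
  ... | inj₁ v∈S              = ∈-closedNbhd⁺ (inj₁ (S⊆S′ v∈S))
  ... | inj₂ (u , u∈S , uv)   = ∈-closedNbhd⁺ (inj₂ (u , S⊆S′ u∈S , uv))

  unobservedNbhd : Subset n → Fin n → Subset n
  unobservedNbhd O u = tabulate λ w → adj G u w ∧ not (lookup O w)

  ∈-unobservedNbhd⁺ : T (adj G u w) → w ∉ O → w ∈ unobservedNbhd O u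
  ∈-unobservedNbhd⁺ uw w∉O = ∈-tabulate⁺ (from T-∧ (uw , ∉⇒T-not w∉O))

  ∈-unobservedNbhd⁻ : w ∈ unobservedNbhd O u → T (adj G u w) × w ∉ O
  ∈-unobservedNbhd⁻ w∈ with to T-∧ (∈-tabulate⁻ w∈)
  ... | uw , w∉O = uw , T-not⇒∉ w∉O

  unobservedNbhd-antitone : O ⊆ O′ → unobservedNbhd O′ u ⊆ unobservedNbhd O u
  unobservedNbhd-antitone O⊆O′ w∈ with ∈-unobservedNbhd⁻ w∈
  ... | uw , w∉O′ = ∈-unobservedNbhd⁺ uw (w∉O′ ∘ O⊆O′)

  Forces : Subset n → Fin n → Fin n → Set
  Forces O u v = u ∈ O × T (adj G u v) × v ∉ O × ∣ unobservedNbhd O u ∣ ≡ 1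

  ∈-step⁺ : v ∈ O ⊎ (∃ λ u → Forces O u v) → v ∈ step G O
  ∈-step⁺ (inj₁ v∈O) = ∈-tabulate⁺ (from T-∨ (inj₁ (∈⇒T v∈O)))
  ∈-step⁺ (inj₂ (u , u∈O , uv , v∉O , forced)) = ∈-tabulate⁺ (from T-∨ (inj₂ (anyV⁺ {x = u}
    (from T-∧ (∈⇒T u∈O , from T-∧ (uv , from T-∧ (∉⇒T-not v∉O , ≡⇒≡ᵇ _ 1 forced)))))))

  ∈-step⁻ : v ∈ step G O → v ∈ O ⊎ ∃ λ u → Forces O u v
  ∈-step⁻ v∈step with to T-∨ (∈-tabulate⁻ v∈step)
  ... | inj₁ v∈O = inj₁ (T⇒∈ v∈O)
  ... | inj₂ forcing with anyV⁻ forcing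
  ...   | u , conds with to T-∧ conds
  ...     | u∈O , conds′ with to T-∧ conds′
  ...       | uv , conds″ with to T-∧ conds″
  ...         | v∉O , forced = inj₂ (u , T⇒∈ u∈O , uv , T-not⇒∉ v∉O , ≡ᵇ⇒≡ _ 1 forced)

  step-inflationary : O ⊆ step G O
  step-inflationary v∈O = ∈-step⁺ (inj₁ v∈O)

  Forces-mono : O ⊆ O′ → v ∉ O′ → Forces O u v → Forces O′ u v
  Forces-mono {v = v} O⊆O′ v∉O′ (u∈O , uv , _ , forced) =
    O⊆O′ u∈O , uv , v∉O′ ,
    ≤-antisym (subst (_ ≤_) forced (p⊆q⇒∣p∣≤∣q∣ (unobservedNbhd-antitone O⊆O′)))
              (x∈p⇒0<∣p∣ (∈-unobservedNbhd⁺ uv v∉O′))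

  step-mono : O ⊆ O′ → step G O ⊆ step G O′
  step-mono {O′ = O′} O⊆O′ {v} v∈step with ∈-step⁻ v∈step | v ∈? O′
  ... | _                 | yes v∈O′ = step-inflationary v∈O′
  ... | inj₁ v∈O          | no  _    = step-inflationary (O⊆O′ v∈O)
  ... | inj₂ (u , forces) | no  v∉O′ = ∈-step⁺ (inj₂ (u , Forces-mono O⊆O′ v∉O′ forces))

  iter-mono : ∀ k → O ⊆ O′ → iter k G O ⊆ iter k G O′
  iter-mono zero    O⊆O′ = O⊆O′
  iter-mono (suc k) O⊆O′ = iter-mono k (step-mono O⊆O′)

  iter-inflationary : ∀ k → O ⊆ iter k G O
  iter-inflationary zero    v∈O = v∈O
  iter-inflationary (suc k) v∈O = iter-inflationary k (step-inflationary v∈O)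

  iter-fixed : step G O ≡ O → ∀ k → iter k G O ≡ O
  iter-fixed step≡ zero    = refl
  iter-fixed step≡ (suc k) rewrite step≡ = iter-fixed step≡ k

  -- Each round that is not stationary observes a new vertex, so n rounds reach a fixed point.
  iter-fixed-or-grows : ∀ k O → step G (iter k G O) ≡ iter k G O ⊎ k + ∣ O ∣ ≤ ∣ iter k G O ∣
  iter-fixed-or-grows zero    O = inj₂ ≤-refl
  iter-fixed-or-grows (suc k) O with O ⊂? step G O
  ... | yes O⊂step = Sum.map₂ grows (iter-fixed-or-grows k (step G O))
    where
    grows : k + ∣ step G O ∣ ≤ ∣ iter (suc k) G O ∣ → suc k + ∣ O ∣ ≤ ∣ iter (suc k) G O ∣
    grows = ≤-trans (subst (_≤ k + ∣ step G O ∣) (+-suc k ∣ O ∣) (+-monoʳ-≤ k (p⊂q⇒∣p∣<∣q∣ O⊂step)))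
  ... | no  O⊄step = inj₁ (subst (λ P → step G P ≡ P) (sym (iter-fixed step≡ (suc k))) step≡)
    where
    step≡ : step G O ≡ O
    step≡ = sym (⊆∧⊄⇒≡ step-inflationary O⊄step)

  Obs-fixed : ∀ S → step G (Obs G S) ≡ Obs G S
  Obs-fixed S with iter-fixed-or-grows n (closedNbhd G S)
  ... | inj₁ fixed = fixed
  ... | inj₂ grown = subst (λ P → step G P ≡ P) (sym Obs≡⊤) (⊆-antisym (λ _ → ∈⊤) step-inflationary)
    where
    Obs≡⊤ : Obs G S ≡ ⊤
    Obs≡⊤ = ∣p∣≡n⇒p≡⊤ (≤-antisym (∣p∣≤n (Obs G S)) (≤-trans (m≤m+n n _) grown))

  closedNbhd⊆Obs : ∀ S → closedNbhd G S ⊆ Obs G S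
  closedNbhd⊆Obs S = iter-inflationary n

  Obs-mono : S ⊆ S′ → Obs G S ⊆ Obs G S′
  Obs-mono S⊆S′ = iter-mono n (closedNbhd-mono S⊆S′)

  Obs-gains-two : S ⊆ S′ → x ≢ y → x ∉ Obs G S → y ∉ Obs G S →
                  x ∈ closedNbhd G S′ → y ∈ closedNbhd G S′ → ∣ Obs G S ∣ + 2 ≤ ∣ Obs G S′ ∣
  Obs-gains-two {S′ = S′} S⊆S′ x≢y x∉Obs y∉Obs x∈N y∈N =
    ∣p∣+2≤∣q∣ (Obs-mono S⊆S′) x≢y (closedNbhd⊆Obs S′ x∈N) x∉Obs (closedNbhd⊆Obs S′ y∈N) y∉Obs

  ∉Obs⇒∉ : v ∉ Obs G S → v ∉ S
  ∉Obs⇒∉ {S = S} v∉Obs = v∉Obs ∘ closedNbhd⊆Obs S ∘ ∈-closedNbhd⁺ ∘ inj₁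

  ∉Obs⇒nbr∉ : v ∉ Obs G S → T (adj G w v) → w ∉ S
  ∉Obs⇒nbr∉ {S = S} v∉Obs wv w∈S = v∉Obs (closedNbhd⊆Obs S (∈-closedNbhd⁺ (inj₂ (_ , w∈S , wv))))

  ∈-closedNbhd-∪⁅x⁆ : ∀ S → x ∈ closedNbhd G (S ∪ ⁅ x ⁆)
  ∈-closedNbhd-∪⁅x⁆ {x = x} S = ∈-closedNbhd⁺ (inj₁ (x∈p∪q⁺ {p = S} (inj₂ (x∈⁅x⁆ x))))

  nbr∈closedNbhd-∪⁅x⁆ : ∀ S → T (adj G x y) → y ∈ closedNbhd G (S ∪ ⁅ x ⁆)
  nbr∈closedNbhd-∪⁅x⁆ {x = x} S xy = ∈-closedNbhd⁺ (inj₂ (x , x∈p∪q⁺ {p = S} (inj₂ (x∈⁅x⁆ x)) , xy))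

  -- An observed vertex with only one unobserved neighbour would force it, but Obs G S is stable.
  second-unobserved-nbr : w ∈ Obs G S → T (adj G w v) → v ∉ Obs G S →
                          ∃ λ b → b ≢ v × T (adj G w b) × b ∉ Obs G S
  second-unobserved-nbr {w = w} {S = S} {v = v} w∈Obs wv v∉Obs
    with x∈p∧∣p∣≢1⇒∃y≢x (∈-unobservedNbhd⁺ wv v∉Obs) cannot-force
    where
    cannot-force : ∣ unobservedNbhd (Obs G S) w ∣ ≢ 1
    cannot-force forced =
      v∉Obs (subst (v ∈_) (Obs-fixed S) (∈-step⁺ (inj₂ (w , w∈Obs , wv , v∉Obs , forced))))
  ... | b , b∈ , b≢v with ∈-unobservedNbhd⁻ b∈
  ...   | wb , b∉Obs = b , b≢v , wb , b∉Obs

  NoIsolatedVertices : Set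
  NoIsolatedVertices = ∀ v → ∃ λ w → T (adj G v w)

  Obs-extend-by-two : NoIsolatedVertices → v ∉ Obs G S →
                      ∃ λ x → x ∉ S × ∣ Obs G S ∣ + 2 ≤ ∣ Obs G (S ∪ ⁅ x ⁆) ∣
  Obs-extend-by-two {v = v} {S = S} noIsolated v∉Obs with noIsolated v
  ... | w , vw with w ∈? Obs G S
  ...   | no w∉Obs =
    v , ∉Obs⇒∉ v∉Obs ,
    Obs-gains-two (p⊆p∪q {p = S} ⁅ v ⁆) (adj⇒≢ vw) v∉Obs w∉Obs
      (∈-closedNbhd-∪⁅x⁆ S) (nbr∈closedNbhd-∪⁅x⁆ S vw)
  ...   | yes w∈Obs with second-unobserved-nbr {S = S} w∈Obs (adj-symᵀ vw) v∉Obs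
  ...     | b , b≢v , wb , b∉Obs =
    w , ∉Obs⇒nbr∉ v∉Obs (adj-symᵀ vw) ,
    Obs-gains-two (p⊆p∪q {p = S} ⁅ w ⁆) (b≢v ∘ sym) v∉Obs b∉Obs
      (nbr∈closedNbhd-∪⁅x⁆ S (adj-symᵀ vw)) (nbr∈closedNbhd-∪⁅x⁆ S wb)

  -- No vertex is adjacent to an isolated v, so no vertex has exactly one neighbour in {v}.
  isolated⇒singleton-fort : (∀ w → ¬ T (adj G v w)) → T (isFort G ⁅ v ⁆)
  isolated⇒singleton-fort {v = v} isolated =
    from T-∧ (anyV⁺ {x = v} (∈⇒T (x∈⁅x⁆ v)) , allV⁺ λ z → from T-∨ (inj₂ (no-nbr-in-⁅v⁆ z)))
    where
    no-nbr-in-⁅v⁆ : ∀ z → T (not (countV (λ u → adj G z u ∧ lookup ⁅ v ⁆ u) ≡ᵇ 1))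
    no-nbr-in-⁅v⁆ z = subst (λ c → T (not (c ≡ᵇ 1))) (sym count≡0) _
      where
      nbrs-empty : Empty (tabulate λ u → adj G z u ∧ lookup ⁅ v ⁆ u)
      nbrs-empty (u , u∈) with to T-∧ (∈-tabulate⁻ u∈)
      ... | zu , u∈⁅v⁆ with x∈⁅y⁆⇒x≡y {x = u} v (T⇒∈ u∈⁅v⁆)
      ...   | refl = isolated z (adj-symᵀ zu)
      count≡0 : countV (λ u → adj G z u ∧ lookup ⁅ v ⁆ u) ≡ 0
      count≡0 = trans (cong ∣_∣ (Empty-unique nbrs-empty)) (∣⊥∣≡0 n)

  minFort≤∣fort∣ : ∀ {F} → T (isFort G F) → minFort G ≤ ∣ F ∣
  minFort≤∣fort∣ {F} = minWhere-≤ (isFort G) ∣_∣ n (allSubsets n) (∈-allSubsets F)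

  2≤minFort⇒noIsolatedVertices : 2 ≤ minFort G → NoIsolatedVertices
  2≤minFort⇒noIsolatedVertices 2≤minFort v with any? (λ w → T? (adj G v w))
  ... | yes nbr  = nbr
  ... | no  ¬nbr = contradiction (≤-trans 2≤minFort (minFort≤∣fort∣ {⁅ v ⁆} singleton-fort)) λ 2≤∣⁅v⁆∣ →
    <⇒≱ (s≤s (s≤s z≤n)) (subst (2 ≤_) (∣⁅x⁆∣≡1 v) 2≤∣⁅v⁆∣)
    where
    singleton-fort : T (isFort G ⁅ v ⁆)
    singleton-fort = isolated⇒singleton-fort λ w vw → ¬nbr (w , vw)

  ∣Obs∣≤maxObs : ∀ S → ∣ S ∣ ≡ k → ∣ Obs G S ∣ ≤ maxObs G k
  ∣Obs∣≤maxObs {k = k} S ∣S∣≡k =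
    ≤-maxWhere (λ S → ∣ S ∣ ≡ᵇ k) (λ S → ∣ Obs G S ∣) (allSubsets n) (∈-allSubsets S) (≡⇒≡ᵇ _ _ ∣S∣≡k)

  maxObs-attained : k ≤ n → ∃ λ S → ∣ S ∣ ≡ k × maxObs G k ≡ ∣ Obs G S ∣
  maxObs-attained {k = k} k≤n with maxWhere-attained (λ S → ∣ S ∣ ≡ᵇ k) (λ S → ∣ Obs G S ∣) (allSubsets n)
  ... | inj₂ (S , ∣S∣≡ᵇk , max≡) = S , ≡ᵇ⇒≡ _ _ ∣S∣≡ᵇk , max≡
  ... | inj₁ max≡0 with subsetOfSize k≤n
  ...   | S , ∣S∣≡k = S , ∣S∣≡k , trans max≡0 (sym (n≤0⇒n≡0 (subst (_ ≤_) max≡0 (∣Obs∣≤maxObs S ∣S∣≡k))))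

  searchPD-≤ : ∀ fuel k → searchPD G fuel k ≤ k + fuel
  searchPD-≤ zero       k = ≤-reflexive (sym (+-identityʳ k))
  searchPD-≤ (suc fuel) k with pdsOfSize G k
  ... | true  = m≤m+n k (suc fuel)
  ... | false = subst (searchPD G fuel (suc k) ≤_) (sym (+-suc k fuel)) (searchPD-≤ fuel (suc k))

  searchPD-minimal : ∀ fuel k j → k ≤ j → j < searchPD G fuel k → ¬ T (pdsOfSize G j)
  searchPD-minimal zero       k j k≤j j<k = contradiction k≤j (<⇒≱ j<k)
  searchPD-minimal (suc fuel) k j k≤j j<s with pdsOfSize G k in pds
  ... | true  = contradiction k≤j (<⇒≱ j<s)
  ... | false with m≤n⇒m<n∨m≡n k≤j
  ...   | inj₁ k<j  = searchPD-minimal fuel (suc k) j k<j j<s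
  ...   | inj₂ refl = subst T pds

  γP≤1+n : γP G ≤ suc n
  γP≤1+n = searchPD-≤ (suc n) 0

  unobserved-below-γP : k < γP G → ∣ S ∣ ≡ k → ∃ λ v → v ∉ Obs G S
  unobserved-below-γP {k = k} {S = S} k<γP ∣S∣≡k =
    ¬∀⟶∃¬ n (_∈ Obs G S) (_∈? Obs G S) λ dominating →
      searchPD-minimal (suc n) 0 k z≤n k<γP
        (any⁺ _ (lose (∈-allSubsets S) (from T-∧ (≡⇒≡ᵇ _ _ ∣S∣≡k , allV⁺ (∈⇒T ∘ dominating)))))

lemma3p4 : (m : ℕ) (G : Graph (suc m)) → 2 ≤ minFort G →
    (i : ℕ) → 1 ≤ i → i ≤ γP G → maxObs G (i ∸ 1) + 2 ≤ maxObs G i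
lemma3p4 m G 2≤minFort (suc k) _ k<γP =
  let S , ∣S∣≡k , max≡ = maxObs-attained G (≤-pred (≤-trans k<γP (γP≤1+n G)))
      v , v∉Obs       = unobserved-below-γP G {S = S} k<γP ∣S∣≡k
      x , x∉S , gain  = Obs-extend-by-two G {S = S} (2≤minFort⇒noIsolatedVertices G 2≤minFort) v∉Obs
  in begin
    maxObs G k + 2        ≡⟨ cong (_+ 2) max≡ ⟩
    ∣ Obs G S ∣ + 2        ≤⟨ gain ⟩
    ∣ Obs G (S ∪ ⁅ x ⁆) ∣  ≤⟨ ∣Obs∣≤maxObs G (S ∪ ⁅ x ⁆) (trans (∣p∪⁅x⁆∣≡1+∣p∣ x∉S) (cong suc ∣S∣≡k)) ⟩
    maxObs G (suc k)       ∎
  where open ≤-Reasoning
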